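{- Let $m\ge2$ and let $G$ be a benzenoid chain of length $m$ with hexagons $h_1,\dots,h_m$ in chain order, where $h_m$ is terminal and shares the edge $c=uv$ with $h_{m-1}$. Let $a$ and $b$ be the edges other than $c$ incident to $u$ in $h_{m-1}$ and in $h_m$, respectively, and let $e$ and $d$ be the edges other than $c$ incident to $v$ in $h_{m-1}$ and in $h_m$, respectively. Then every maximal matching $M$ of $G$ contains at least one of the edges $a,b,c,d,e$; moreover, $M\cap\{a,b,c,d,e\}$ is either a single edge or exactly one of the pairs $\{a,e\}$, $\{a,d\}$, $\{b,e\}$, $\{b,d\}$.
   Context: All graphs are finite and simple. A matching of a graph $G$ is a set of edges no two of which share a vertex; it is maximal if it is not a proper subset of another matching of $G$. A hexagon is a cycle on 6 vertices. A benzenoid chain of length $m\ge1$ is a graph that is the union of $m$ hexagons $h_1,\dots,h_m$ such that, for $1\le i\le m-1$, $h_i$ and $h_{i+1}$ share exactly one edge (and its two endpoints) and no other vertex, hexagons $h_i,h_j$ with $|i-j|\ge2$ are vertex-disjoint, and no vertex lies in three hexagons. -}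

module Defs where

open import Data.Nat using (ℕ; suc; _<_)
open import Data.Fin using (Fin; zero; suc; toℕ)
open import Data.Bool using (Bool; true; false)
open import Data.Product using (Σ; ∃; ∃-syntax; _×_; _,_)
open import Data.Sum using (_⊎_)
open import Data.List using (List; []; _∷_)
open import Data.List.Membership.Propositional using (_∈_)
open import Relation.Binary.PropositionalEquality using (_≡_; _≢_)
open import Relation.Nullary using (¬_)

record Graph (n : ℕ) : Set where
  field
    adj     : Fin n → Fin n → Bool
    adj-sym : ∀ x y → adj x y ≡ adj y x
    adj-irr : ∀ x → adj x x ≡ false

open Graph public

Adjacent : ∀ {n} → Graph n → Fin n → Fin n → Set
Adjacent G x y = adj G x y ≡ true

-- Edge sets of G (subsets of E(G)), given by symmetric Boolean indicators.

EdgeSet : ℕ → Set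
EdgeSet n = Fin n → Fin n → Bool

_⊆ₑ_ : ∀ {n} → EdgeSet n → EdgeSet n → Set
M ⊆ₑ M' = ∀ x y → M x y ≡ true → M' x y ≡ true

record IsMatching {n} (G : Graph n) (M : EdgeSet n) : Set where
  field
    edges  : ∀ x y → M x y ≡ true → Adjacent G x y
    sym    : ∀ x y → M x y ≡ M y x
    unique : ∀ x y z → M x y ≡ true → M x z ≡ true → y ≡ z

IsMaximalMatching : ∀ {n} → Graph n → EdgeSet n → Set
IsMaximalMatching G M =
  IsMatching G M ×
  ¬ (Σ (EdgeSet _) λ M' → IsMatching G M' × M ⊆ₑ M' × ¬ (M' ⊆ₑ M))

-- Hexagons: a hexagon is given by an injective cyclic listing
-- h 0, h 1, ..., h 5 of its vertices; its edges are {h i, h (i+1 mod 6)}.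

next : Fin 6 → Fin 6
next zero = suc zero
next (suc zero) = suc (suc zero)
next (suc (suc zero)) = suc (suc (suc zero))
next (suc (suc (suc zero))) = suc (suc (suc (suc zero)))
next (suc (suc (suc (suc zero)))) = suc (suc (suc (suc (suc zero))))
next (suc (suc (suc (suc (suc zero))))) = zero

Hexagon : ℕ → Set
Hexagon n = Fin 6 → Fin n

InHex : ∀ {n} → Hexagon n → Fin n → Set
InHex h x = ∃[ i ] h i ≡ x

HexEdge : ∀ {n} → Hexagon n → Fin n → Fin n → Set
HexEdge h x y = ∃[ i ] ((h i ≡ x × h (next i) ≡ y) ⊎ (h i ≡ y × h (next i) ≡ x))

-- A benzenoid chain of length m: G is the union of the hexagons
-- hex 0, ..., hex (m-1) (chain order), with the chain conditions.

record BenzenoidChain {n} (G : Graph n) (m : ℕ) : Set where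
  field
    hex        : Fin m → Hexagon n
    hex-inj    : ∀ k i j → hex k i ≡ hex k j → i ≡ j
    hex-edge   : ∀ k i → Adjacent G (hex k i) (hex k (next i))
    cover-vert : ∀ x → ∃[ k ] InHex (hex k) x
    cover-edge : ∀ x y → Adjacent G x y → ∃[ k ] HexEdge (hex k) x y
    consecutive : ∀ k l → toℕ l ≡ suc (toℕ k) →
      ∃[ p ] ∃[ q ] (HexEdge (hex k) p q × HexEdge (hex l) p q ×
        (∀ x → InHex (hex k) x → InHex (hex l) x → x ≡ p ⊎ x ≡ q))
    far : ∀ k l → suc (toℕ k) < toℕ l →
      ∀ x → InHex (hex k) x → ¬ InHex (hex l) x
    no-three : ∀ i j k → i ≢ j → j ≢ k → i ≢ k →
      ∀ x → InHex (hex i) x → InHex (hex j) x → ¬ InHex (hex k) x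

open BenzenoidChain public

-- Membership patterns of (a , b , c , d , e) in M.

Pattern : Set
Pattern = Bool × Bool × Bool × Bool × Bool

AtLeastOne : Pattern → Set
AtLeastOne (a , b , c , d , e) =
  a ≡ true ⊎ b ≡ true ⊎ c ≡ true ⊎ d ≡ true ⊎ e ≡ true

allowedPatterns : List Pattern
allowedPatterns =
    (true  , false , false , false , false)
  ∷ (false , true  , false , false , false)
  ∷ (false , false , true  , false , false)
  ∷ (false , false , false , true  , false)
  ∷ (false , false , false , false , true )
  ∷ (true  , false , false , false , true )
  ∷ (true  , false , false , true  , false)
  ∷ (false , true  , false , false , true )
  ∷ (false , true  , false , true  , false)
  ∷ []

Allowed : Pattern → Set
Allowed p = p ∈ allowedPatterns

module Submission where

-- Since no vertex lies in three hexagons, every edge of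
-- G at u is an edge of h_{m-1} or h_m, so the neighbours of u are exactly v, a'
-- and b' (and symmetrically those of v are u, e' and d').  Consecutive hexagons
-- meet only in u and v, so a' ≠ b' and e' ≠ d'.  Hence a matching contains at
-- most one of a, b, c (the edges at u) and at most one of c, d, e (the edges at
-- v).  A maximal matching cannot leave both ends of the edge uv uncovered, so
-- at least one of a, ..., e lies in M.  The two "at most one" constraints plus
-- "at least one" leave exactly the nine allowed patterns.

open import Defs
open import Data.Nat using (suc; _≤_)
open import Data.Nat.Properties using (1+n≢n)
open import Data.Fin using (Fin; toℕ; zero; suc; _≟_)
open import Data.Bool using (Bool; true; false; _∨_)
open import Data.Bool.Properties using (∨-zeroʳ)
open import Data.Product using (_×_; _,_; ∃-syntax)
open import Data.Sum using (_⊎_; inj₁; inj₂; map₂)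
open import Data.Empty using (⊥; ⊥-elim)
open import Data.List.Relation.Unary.Any using (here; there)
open import Relation.Nullary using (¬_; Dec; yes; no; does)
open import Relation.Nullary.Decidable using (_×-dec_; _⊎-dec_; dec-true; dec-false)
open import Relation.Binary.PropositionalEquality
  using (_≡_; _≢_; refl; sym; trans; cong; cong₂; subst)

among-two : ∀ {A : Set} {p q x y z : A} →
  y ≡ p ⊎ y ≡ q → z ≡ p ⊎ z ≡ q → y ≢ z → x ≡ p ⊎ x ≡ q → x ≡ y ⊎ x ≡ z
among-two (inj₁ refl) (inj₁ refl) y≢z _           = ⊥-elim (y≢z refl)
among-two (inj₂ refl) (inj₂ refl) y≢z _           = ⊥-elim (y≢z refl)
among-two (inj₁ refl) (inj₂ refl) _   (inj₁ refl) = inj₁ refl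
among-two (inj₁ refl) (inj₂ refl) _   (inj₂ refl) = inj₂ refl
among-two (inj₂ refl) (inj₁ refl) _   (inj₁ refl) = inj₂ refl
among-two (inj₂ refl) (inj₁ refl) _   (inj₂ refl) = inj₁ refl

adjacent-distinct : ∀ {n} (G : Graph n) {x y} → Adjacent G x y → x ≢ y
adjacent-distinct G {x} xy refl with trans (sym xy) (adj-irr G x)
... | ()

Free : ∀ {n} → EdgeSet n → Fin n → Set
Free M x = ∀ y → M x y ≡ false

module AddEdge {n} {G : Graph n} {M : EdgeSet n} (isM : IsMatching G M)
  {u v : Fin n} (uv : Adjacent G u v) (free-u : Free M u) (free-v : Free M v) where

  Link : Fin n → Fin n → Set
  Link x y = (x ≡ u × y ≡ v) ⊎ (x ≡ v × y ≡ u)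

  link? : ∀ x y → Dec (Link x y)
  link? x y = ((x ≟ u) ×-dec (y ≟ v)) ⊎-dec ((x ≟ v) ×-dec (y ≟ u))

  link-sym : ∀ {x y} → Link x y → Link y x
  link-sym (inj₁ (p , q)) = inj₂ (q , p)
  link-sym (inj₂ (p , q)) = inj₁ (q , p)

  link-disjoint : ∀ {x y z} → Link x y → M x z ≡ true → ⊥
  link-disjoint {z = z} (inj₁ (refl , _)) e with trans (sym e) (free-u z)
  ... | ()
  link-disjoint {z = z} (inj₂ (refl , _)) e with trans (sym e) (free-v z)
  ... | ()

  link-functional : ∀ {x y z} → Link x y → Link x z → y ≡ z
  link-functional (inj₁ (_ , p)) (inj₁ (_ , q)) = trans p (sym q)
  link-functional (inj₂ (_ , p)) (inj₂ (_ , q)) = trans p (sym q)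
  link-functional (inj₁ (p , _)) (inj₂ (q , _)) =
    ⊥-elim (adjacent-distinct G uv (trans (sym p) q))
  link-functional (inj₂ (p , _)) (inj₁ (q , _)) =
    ⊥-elim (adjacent-distinct G uv (trans (sym q) p))

  M⁺ : EdgeSet n
  M⁺ x y = does (link? x y) ∨ M x y

  old-or-new : ∀ {x y} → M⁺ x y ≡ true → Link x y ⊎ M x y ≡ true
  old-or-new {x} {y} = split (link? x y)
    where
    split : (d : Dec (Link x y)) → does d ∨ M x y ≡ true → Link x y ⊎ M x y ≡ true
    split (yes p) _ = inj₁ p
    split (no _)  e = inj₂ e

  link?-sym : ∀ x y → does (link? x y) ≡ does (link? y x)
  link?-sym x y = by-cases (link? x y)
    where
    by-cases : (d : Dec (Link x y)) → does d ≡ does (link? y x)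
    by-cases (yes p) = sym (dec-true (link? y x) (link-sym p))
    by-cases (no ¬p) = sym (dec-false (link? y x) (λ p → ¬p (link-sym p)))

  isMatching⁺ : IsMatching G M⁺
  isMatching⁺ = record { edges = edges ; sym = symmetric ; unique = unique }
    where
    edges : ∀ x y → M⁺ x y ≡ true → Adjacent G x y
    edges x y e with old-or-new e
    ... | inj₁ (inj₁ (refl , refl)) = uv
    ... | inj₁ (inj₂ (refl , refl)) = trans (adj-sym G v u) uv
    ... | inj₂ old                  = IsMatching.edges isM x y old
    symmetric : ∀ x y → M⁺ x y ≡ M⁺ y x
    symmetric x y = cong₂ _∨_ (link?-sym x y) (IsMatching.sym isM x y)
    unique : ∀ x y z → M⁺ x y ≡ true → M⁺ x z ≡ true → y ≡ z
    unique x y z e₁ e₂ with old-or-new e₁ | old-or-new e₂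
    ... | inj₁ l₁ | inj₁ l₂ = link-functional l₁ l₂
    ... | inj₁ l₁ | inj₂ o₂ = ⊥-elim (link-disjoint l₁ o₂)
    ... | inj₂ o₁ | inj₁ l₂ = ⊥-elim (link-disjoint l₂ o₁)
    ... | inj₂ o₁ | inj₂ o₂ = IsMatching.unique isM x y z o₁ o₂

  extends : M ⊆ₑ M⁺
  extends x y e = trans (cong (does (link? x y) ∨_) e) (∨-zeroʳ _)

  new-edge : M⁺ u v ≡ true
  new-edge = cong (_∨ M u v) (dec-true (link? u v) (inj₁ (refl , refl)))

  strictly : ¬ (M⁺ ⊆ₑ M)
  strictly sub with trans (sym (sub u v new-edge)) (free-u v)
  ... | ()

maximal-no-free-edge : ∀ {n} {G : Graph n} {M : EdgeSet n} → IsMaximalMatching G M →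
  ∀ {u v} → Adjacent G u v → Free M u → Free M v → ⊥
maximal-no-free-edge (isM , maximal) uv free-u free-v =
  maximal (M⁺ , isMatching⁺ , extends , strictly)
  where open AddEdge isM uv free-u free-v

free-vertex : ∀ {n} {G : Graph n} {M : EdgeSet n} → IsMatching G M →
  ∀ {x p q r} → (∀ {y} → Adjacent G x y → y ≡ p ⊎ y ≡ q ⊎ y ≡ r) →
  M x p ≡ false → M x q ≡ false → M x r ≡ false → Free M x
free-vertex {M = M} isM {x} nbrs fp fq fr y with M x y in e
... | false = refl
... | true with nbrs (IsMatching.edges isM x y e)
...   | inj₁ refl        = trans (sym e) fp
...   | inj₂ (inj₁ refl) = trans (sym e) fq
...   | inj₂ (inj₂ refl) = trans (sym e) fr

data AtMostOne : Bool → Bool → Bool → Set where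
  none   : AtMostOne false false false
  first  : AtMostOne true  false false
  second : AtMostOne false true  false
  third  : AtMostOne false false true

matching-atMostOne : ∀ {n} {G : Graph n} {M : EdgeSet n} → IsMatching G M →
  ∀ {w x y z} → x ≢ y → y ≢ z → x ≢ z → AtMostOne (M w x) (M w y) (M w z)
matching-atMostOne {M = M} isM {w} {x} {y} {z} x≢y y≢z x≢z
  with M w x in ex | M w y in ey | M w z in ez
... | false | false | false = none
... | true  | false | false = first
... | false | true  | false = second
... | false | false | true  = third
... | true  | true  | _     = ⊥-elim (x≢y (IsMatching.unique isM w x y ex ey))
... | _     | true  | true  = ⊥-elim (y≢z (IsMatching.unique isM w y z ey ez))
... | true  | false | true  = ⊥-elim (x≢z (IsMatching.unique isM w x z ex ez))

prev : Fin 6 → Fin 6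
prev zero                                = suc (suc (suc (suc (suc zero))))
prev (suc zero)                          = zero
prev (suc (suc zero))                    = suc zero
prev (suc (suc (suc zero)))              = suc (suc zero)
prev (suc (suc (suc (suc zero))))        = suc (suc (suc zero))
prev (suc (suc (suc (suc (suc zero))))) = suc (suc (suc (suc zero)))

prev-next : ∀ i → prev (next i) ≡ i
prev-next zero                                = refl
prev-next (suc zero)                          = refl
prev-next (suc (suc zero))                    = refl
prev-next (suc (suc (suc zero)))              = refl
prev-next (suc (suc (suc (suc zero))))        = refl
prev-next (suc (suc (suc (suc (suc zero))))) = refl

hexEdge-sym : ∀ {n} {h : Hexagon n} {x y} → HexEdge h x y → HexEdge h y x
hexEdge-sym (i , inj₁ (p , q)) = i , inj₂ (p , q)
hexEdge-sym (i , inj₂ (p , q)) = i , inj₁ (p , q)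

hexEdge-left : ∀ {n} {h : Hexagon n} {x y} → HexEdge h x y → InHex h x
hexEdge-left (i , inj₁ (p , _)) = i , p
hexEdge-left (i , inj₂ (_ , q)) = next i , q

hexEdge-position : ∀ {n} {h : Hexagon n} {x y} → HexEdge h x y →
  ∃[ s ] (h s ≡ x × (y ≡ h (next s) ⊎ y ≡ h (prev s)))
hexEdge-position (i , inj₁ (p , q)) = i , p , inj₁ (sym q)
hexEdge-position {h = h} (i , inj₂ (p , q)) =
  next i , q , inj₂ (trans (sym p) (cong h (sym (prev-next i))))

hexagon-two-neighbours : ∀ {n} {h : Hexagon n} → (∀ i j → h i ≡ h j → i ≡ j) →
  ∀ {x v a y} → HexEdge h x v → HexEdge h x a → a ≢ v → HexEdge h x y →
  y ≡ v ⊎ y ≡ a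
hexagon-two-neighbours inj xv xa a≢v xy
  with hexEdge-position xv | hexEdge-position xa | hexEdge-position xy
... | s , hs≡x , v∈ | s′ , hs′≡x , a∈ | s″ , hs″≡x , y∈
  with inj s′ s (trans hs′≡x (sym hs≡x)) | inj s″ s (trans hs″≡x (sym hs≡x))
... | refl | refl = among-two v∈ a∈ (λ v≡a → a≢v (sym v≡a)) y∈

hexEdge-adjacent : ∀ {n m} {G : Graph n} (B : BenzenoidChain G m) k {x y} →
  HexEdge (hex B k) x y → Adjacent G x y
hexEdge-adjacent B k (i , inj₁ (refl , refl)) = hex-edge B k i
hexEdge-adjacent {G = G} B k (i , inj₂ (refl , refl)) =
  trans (adj-sym G (hex B k (next i)) (hex B k i)) (hex-edge B k i)

module SharedEdge {n m} {G : Graph n} (B : BenzenoidChain G m)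
  {k l : Fin m} (l≡1+k : toℕ l ≡ suc (toℕ k))
  {u v : Fin n} (uvₖ : HexEdge (hex B k) u v) (uvₗ : HexEdge (hex B l) u v) where

  k≢l : k ≢ l
  k≢l refl = 1+n≢n (sym l≡1+k)

  u≢v : u ≢ v
  u≢v = adjacent-distinct G (hexEdge-adjacent B k uvₖ)

  common-vertex : ∀ {x} → InHex (hex B k) x → InHex (hex B l) x → x ≡ u ⊎ x ≡ v
  common-vertex x∈k x∈l with consecutive B k l l≡1+k
  ... | _ , _ , _ , _ , only-pq =
    among-two (only-pq u (hexEdge-left uvₖ) (hexEdge-left uvₗ))
              (only-pq v (hexEdge-left (hexEdge-sym uvₖ)) (hexEdge-left (hexEdge-sym uvₗ)))
              u≢v (only-pq _ x∈k x∈l)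

  hexagons-at-u : ∀ j → InHex (hex B j) u → j ≡ k ⊎ j ≡ l
  hexagons-at-u j u∈j with j ≟ k | j ≟ l
  ... | yes j≡k | _       = inj₁ j≡k
  ... | no _    | yes j≡l = inj₂ j≡l
  ... | no j≢k  | no j≢l  =
    ⊥-elim (no-three B k l j k≢l (λ l≡j → j≢l (sym l≡j)) (λ k≡j → j≢k (sym k≡j))
              u (hexEdge-left uvₖ) (hexEdge-left uvₗ) u∈j)

  module _ {a b : Fin n} (uaₖ : HexEdge (hex B k) u a) (a≢v : a ≢ v)
                         (ubₗ : HexEdge (hex B l) u b) (b≢v : b ≢ v) where

    other-neighbours-distinct : a ≢ b
    other-neighbours-distinct refl
      with common-vertex (hexEdge-left (hexEdge-sym uaₖ)) (hexEdge-left (hexEdge-sym ubₗ))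
    ... | inj₁ a≡u = adjacent-distinct G (hexEdge-adjacent B k uaₖ) (sym a≡u)
    ... | inj₂ a≡v = a≢v a≡v

    neighbours : ∀ {y} → Adjacent G u y → y ≡ v ⊎ y ≡ a ⊎ y ≡ b
    neighbours {y} uy with cover-edge B u y uy
    ... | j , uyⱼ with hexagons-at-u j (hexEdge-left uyⱼ)
    ...   | inj₁ refl = map₂ inj₁ (hexagon-two-neighbours (hex-inj B k) uvₖ uaₖ a≢v uyⱼ)
    ...   | inj₂ refl = map₂ inj₂ (hexagon-two-neighbours (hex-inj B l) uvₗ ubₗ b≢v uyⱼ)

classify-pattern : ∀ {a b c d e} → AtMostOne a b c → AtMostOne c d e →
  (a ≡ false → b ≡ false → c ≡ false → d ≡ false → e ≡ false → ⊥) →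
  AtLeastOne (a , b , c , d , e) × Allowed (a , b , c , d , e)
classify-pattern none   none   not-all-false = ⊥-elim (not-all-false refl refl refl refl refl)
classify-pattern none   second _ = inj₂ (inj₂ (inj₂ (inj₁ refl))) , there (there (there (here refl)))
classify-pattern none   third  _ = inj₂ (inj₂ (inj₂ (inj₂ refl))) , there (there (there (there (here refl))))
classify-pattern first  none   _ = inj₁ refl , here refl
classify-pattern first  second _ = inj₁ refl , there (there (there (there (there (there (here refl))))))
classify-pattern first  third  _ = inj₁ refl , there (there (there (there (there (here refl)))))
classify-pattern second none   _ = inj₂ (inj₁ refl) , there (here refl)
classify-pattern second second _ = inj₂ (inj₁ refl) , there (there (there (there (there (there (there (there (here refl))))))))
classify-pattern second third  _ = inj₂ (inj₁ refl) , there (there (there (there (there (there (there (here refl)))))))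
classify-pattern third  first  _ = inj₂ (inj₂ (inj₁ refl)) , there (there (here refl))

mainTheorem9 : ∀ {n m} (G : Graph n) (B : BenzenoidChain G m) → 2 ≤ m →
    (k l : Fin m) → toℕ l ≡ suc (toℕ k) → suc (toℕ l) ≡ m →
    (u v a' b' d' e' : Fin n) →
    HexEdge (hex B k) u v → HexEdge (hex B l) u v →
    HexEdge (hex B k) u a' → a' ≢ v →
    HexEdge (hex B l) u b' → b' ≢ v →
    HexEdge (hex B k) v e' → e' ≢ u →
    HexEdge (hex B l) v d' → d' ≢ u →
    (M : EdgeSet n) → IsMaximalMatching G M →
    AtLeastOne (M u a' , M u b' , M u v , M v d' , M v e') ×
    Allowed (M u a' , M u b' , M u v , M v d' , M v e')
mainTheorem9 G B _ k l l≡1+k _ u v a' b' d' e' uvₖ uvₗ ua'ₖ a'≢v ub'ₗ b'≢v ve'ₖ e'≢u vd'ₗ d'≢u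
  M maximal@(isM , _) =
  classify-pattern at-u at-v not-all-false
  where
  module AtU = SharedEdge B l≡1+k uvₖ uvₗ
  module AtV = SharedEdge B l≡1+k (hexEdge-sym uvₖ) (hexEdge-sym uvₗ)

  vu≡uv : M v u ≡ M u v
  vu≡uv = IsMatching.sym isM v u

  at-u : AtMostOne (M u a') (M u b') (M u v)
  at-u = matching-atMostOne isM (AtU.other-neighbours-distinct ua'ₖ a'≢v ub'ₗ b'≢v) b'≢v a'≢v

  at-v : AtMostOne (M u v) (M v d') (M v e')
  at-v = subst (λ c → AtMostOne c (M v d') (M v e')) vu≡uv
    (matching-atMostOne isM (λ u≡d' → d'≢u (sym u≡d'))
       (λ d'≡e' → AtV.other-neighbours-distinct ve'ₖ e'≢u vd'ₗ d'≢u (sym d'≡e'))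
       (λ u≡e' → e'≢u (sym u≡e')))

  not-all-false : M u a' ≡ false → M u b' ≡ false → M u v ≡ false →
    M v d' ≡ false → M v e' ≡ false → ⊥
  not-all-false a∉ b∉ c∉ d∉ e∉ =
    maximal-no-free-edge maximal (hexEdge-adjacent B k uvₖ)
      (free-vertex isM (AtU.neighbours ua'ₖ a'≢v ub'ₗ b'≢v) c∉ a∉ b∉)
      (free-vertex isM (AtV.neighbours ve'ₖ e'≢u vd'ₗ d'≢u) (trans vu≡uv c∉) e∉ d∉)
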